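{- Let $\mathcal{BIP}$ be the class of bipartite graphs. Then (i) $R_{1}^{\mathcal{BIP}}(3,j)=j$ for all integers $j\geq 3$; and (ii) $R_{1}^{\mathcal{BIP}}(i,j)=2j-1$ for all integers $i\geq 5$ and $j\geq 3$.
   Context: All graphs are finite and simple. For a graph $G$ and an integer $k\ge 0$, a $k$-sparse $j$-set is a set of exactly $j$ vertices of $G$ inducing a subgraph of maximum degree at most $k$; a $k$-dense $i$-set is a set of exactly $i$ vertices that is $k$-sparse in the complement of $G$. For a graph class $\mathcal{G}$, $R_k^{\mathcal{G}}(i,j)$ is the smallest natural number $n$ such that every graph on $n$ vertices in $\mathcal{G}$ has a $k$-dense $i$-set or a $k$-sparse $j$-set. -}

module Defs where

open import Data.Nat using (ℕ; _≤_; _<_)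
open import Data.Bool using (Bool; true; false; not; _∧_)
open import Data.Fin using (Fin; _≟_)

open import Data.Fin.Subset using (Subset; _∈_; _∩_; ∣_∣)
open import Data.Vec using (tabulate)
open import Data.Product using (Σ; ∃; _×_; _,_)
open import Data.Sum using (_⊎_)
open import Relation.Nullary using (¬_; yes; no)
open import Relation.Nullary.Decidable using (⌊_⌋)
open import Relation.Binary.PropositionalEquality using (_≡_; refl; sym; cong)

record Graph (n : ℕ) : Set where
  field
    adj    : Fin n → Fin n → Bool
    adj-sym    : ∀ u v → adj u v ≡ adj v u
    adj-irrefl : ∀ v → adj v v ≡ false
open Graph public

private
  eqb : ∀ {n} → Fin n → Fin n → Bool
  eqb u v = ⌊ u ≟ v ⌋

  eqb-sym : ∀ {n} (u v : Fin n) → eqb u v ≡ eqb v u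
  eqb-sym u v with u ≟ v | v ≟ u
  ... | yes _ | yes _ = refl
  ... | no _  | no _  = refl
  ... | yes p | no q  with q (sym p)
  ... | ()
  eqb-sym u v | no p | yes q with p (sym q)
  ... | ()

  eqb-refl : ∀ {n} (v : Fin n) → eqb v v ≡ true
  eqb-refl v with v ≟ v
  ... | yes _ = refl
  ... | no p with p refl
  ... | ()

complement : ∀ {n} → Graph n → Graph n
complement {n} G = record
  { adj    = λ u v → not (adj G u v) ∧ not (eqb u v)
  ; adj-sym    = λ u v → cong₂' (adj-sym G u v) (eqb-sym u v)
  ; adj-irrefl = λ v → irr v
  }
  where
  cong₂' : ∀ {a b c d : Bool} → a ≡ b → c ≡ d → not a ∧ not c ≡ not b ∧ not d
  cong₂' refl refl = refl
  irr : ∀ v → not (adj G v v) ∧ not (eqb v v) ≡ false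
  irr v rewrite eqb-refl v = Data.Bool.Properties.∧-zeroʳ (not (adj G v v))
    where import Data.Bool.Properties

nbhd : ∀ {n} → Graph n → Fin n → Subset n
nbhd G v = tabulate (adj G v)

Bipartite : ∀ {n} → Graph n → Set
Bipartite {n} G =
  Σ (Fin n → Bool) λ c → ∀ u v → adj G u v ≡ true → ¬ (c u ≡ c v)

SparseSet : ∀ {n} → Graph n → ℕ → ℕ → Subset n → Set
SparseSet G k j S = (∣ S ∣ ≡ j) × (∀ v → v ∈ S → ∣ S ∩ nbhd G v ∣ ≤ k)

DenseSet : ∀ {n} → Graph n → ℕ → ℕ → Subset n → Set
DenseSet G k i S = SparseSet (complement G) k i S

HasDenseOrSparse : ∀ {n} → Graph n → ℕ → ℕ → ℕ → Set
HasDenseOrSparse G k i j = (∃ λ S → DenseSet G k i S) ⊎ (∃ λ S → SparseSet G k j S)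

RamseyProp : (∀ {n} → Graph n → Set) → ℕ → ℕ → ℕ → ℕ → Set
RamseyProp 𝒢 k i j m = (G : Graph m) → 𝒢 G → HasDenseOrSparse G k i j

RamseyNumberIs : (∀ {n} → Graph n → Set) → ℕ → ℕ → ℕ → ℕ → Set
RamseyNumberIs 𝒢 k i j m =
  RamseyProp 𝒢 k i j m × (∀ n → n < m → ¬ RamseyProp 𝒢 k i j n)

{-# OPTIONS --safe #-}
-- (i) In any graph in which every vertex has degree at most 1 the whole vertex set is 1-sparse;
-- otherwise a vertex v with two neighbours u, w spans a 1-dense triple {v, u, w}, since in the
-- complement only u and w can be adjacent. Below j vertices the edgeless graph has neither set.
-- (ii) In a bipartite graph on 2j − 1 vertices one colour class has j vertices and is independent.
-- On at most 2j − 2 vertices, K_{a,b} with a, b ≤ j − 1 has neither set: each side is a clique of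
-- the complement, so a 1-dense set has at most 2 + 2 < i vertices; a 1-sparse set meeting both
-- sides has at most one vertex on each, so it has at most max (j − 1) 2 < j vertices.

module Submission where

open import Defs
open import Data.Bool using (Bool; true; false; _xor_)
open import Data.Bool.Properties using (xor-comm; xor-same)
open import Data.Fin using (Fin; zero; suc; _≟_)
open import Data.Fin.Properties using (all?; ¬∀⟶∃¬; suc-injective)
open import Data.Fin.Subset
  using (Subset; _∈_; _⊆_; _∩_; _∪_; ∁; ⁅_⁆; _-_; ∣_∣; ⊤; ⊥; inside; outside; Nonempty)
open import Data.Fin.Subset.Properties
  using ( nonempty?; Empty-unique; ∣⊥∣≡0; ∣⊤∣≡n; ∣p∣≤n; ⊥⊆; ∉⊥; s⊆s; ∩-identityˡ
        ; ∣⁅x⁆∣≡1; x∈⁅x⁆; x∈⁅y⁆⇒x≡y; p⊆q⇒∣p∣≤∣q∣; x∈p∩q⁺; x∈p∩q⁻; p∩q⊆p; ∣p∩q∣≤∣q∣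
        ; x∈p∪q⁺; x∈p∪q⁻; x∈∁p⇒x∉p; x∉p⇒x∈∁p; ∣∁p∣≡n∸∣p∣; x∈p∧x≢y⇒x∈p-y; x∈p⇒∣p-x∣<∣p∣ )
open import Data.Nat using (ℕ; zero; suc; _≤_; _<_; _+_; _*_; _∸_; z≤n; s≤s; _≤?_)
open import Data.Nat.Properties
  using ( ≤-trans; ≤-reflexive; ≤-pred; <⇒≤; <⇒≱; ≰⇒>; 1+n≰n; +-mono-≤; +-suc; +-identityʳ
        ; m+[n∸m]≡n; m≤n+o⇒m∸n≤o; module ≤-Reasoning )
open import Data.Product using (∃; ∃₂; _×_; _,_; proj₁; proj₂)
open import Data.Sum using (_⊎_; inj₁; inj₂)
open import Data.Vec using ([]; _∷_; here; there; lookup; tabulate)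
open import Data.Vec.Properties using (lookup∘tabulate; []=⇒lookup; lookup⇒[]=)
open import Function using (_∘_; id)
open import Relation.Nullary using (¬_; yes; no; contradiction)
open import Relation.Binary.PropositionalEquality
  using (_≡_; _≢_; refl; sym; trans; cong; subst; subst₂)

private
  variable
    n i j k : ℕ
    x y z u v w : Fin n
    p S T A : Subset n

∣p∣≡∣p∩q∣+∣p∩∁q∣ : ∀ (p q : Subset n) → ∣ p ∣ ≡ ∣ p ∩ q ∣ + ∣ p ∩ ∁ q ∣
∣p∣≡∣p∩q∣+∣p∩∁q∣ []            []            = refl
∣p∣≡∣p∩q∣+∣p∩∁q∣ (outside ∷ p) (_ ∷ q)       = ∣p∣≡∣p∩q∣+∣p∩∁q∣ p q
∣p∣≡∣p∩q∣+∣p∩∁q∣ (inside ∷ p)  (inside ∷ q)  = cong suc (∣p∣≡∣p∩q∣+∣p∩∁q∣ p q)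
∣p∣≡∣p∩q∣+∣p∩∁q∣ (inside ∷ p)  (outside ∷ q) =
  trans (cong suc (∣p∣≡∣p∩q∣+∣p∩∁q∣ p q)) (sym (+-suc _ _))

∣p∣+∣∁p∣≡n : ∀ (p : Subset n) → ∣ p ∣ + ∣ ∁ p ∣ ≡ n
∣p∣+∣∁p∣≡n p = trans (cong (∣ p ∣ +_) (∣∁p∣≡n∸∣p∣ p)) (m+[n∸m]≡n (∣p∣≤n p))

∣p∣≡0⊎Nonempty : ∀ (p : Subset n) → ∣ p ∣ ≡ 0 ⊎ Nonempty p
∣p∣≡0⊎Nonempty {n} p with nonempty? p
... | yes ne = inj₂ ne
... | no ¬ne = inj₁ (trans (cong ∣_∣ (Empty-unique ¬ne)) (∣⊥∣≡0 n))

subsingleton⇒∣p∣≤1 : (∀ {x y} → x ∈ p → y ∈ p → x ≡ y) → ∣ p ∣ ≤ 1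
subsingleton⇒∣p∣≤1 {p = p} unique with ∣p∣≡0⊎Nonempty p
... | inj₁ ∣p∣≡0       = ≤-trans (≤-reflexive ∣p∣≡0) z≤n
... | inj₂ (x , x∈p) = subst (∣ p ∣ ≤_) (∣⁅x⁆∣≡1 x)
  (p⊆q⇒∣p∣≤∣q∣ (λ y∈p → subst (_∈ ⁅ x ⁆) (unique x∈p y∈p) (x∈⁅x⁆ x)))

two-distinct : ∀ (p : Subset n) → 2 ≤ ∣ p ∣ → ∃₂ λ x y → x ∈ p × y ∈ p × x ≢ y
two-distinct (outside ∷ p) 2≤∣p∣ with two-distinct p 2≤∣p∣
... | x , y , x∈p , y∈p , x≢y = suc x , suc y , there x∈p , there y∈p , x≢y ∘ suc-injective
two-distinct (inside ∷ p) (s≤s 1≤∣p∣) with ∣p∣≡0⊎Nonempty p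
... | inj₁ ∣p∣≡0       = contradiction (≤-trans 1≤∣p∣ (≤-reflexive ∣p∣≡0)) λ ()
... | inj₂ (y , y∈p) = zero , suc y , here , there y∈p , λ ()

three-distinct⇒3≤∣p∣ : x ∈ p → y ∈ p → z ∈ p → x ≢ y → x ≢ z → y ≢ z → 3 ≤ ∣ p ∣
three-distinct⇒3≤∣p∣ {x = x} {p = p} {y = y} {z = z} x∈p y∈p z∈p x≢y x≢z y≢z =
  ≤-trans (s≤s (s≤s 1≤∣p-x-y∣))
          (≤-trans (s≤s (x∈p⇒∣p-x∣<∣p∣ y∈p-x)) (x∈p⇒∣p-x∣<∣p∣ x∈p))
  where
  y∈p-x : y ∈ p - x
  y∈p-x = x∈p∧x≢y⇒x∈p-y y∈p (x≢y ∘ sym)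
  z∈p-x-y : z ∈ p - x - y
  z∈p-x-y = x∈p∧x≢y⇒x∈p-y (x∈p∧x≢y⇒x∈p-y z∈p (x≢z ∘ sym)) (y≢z ∘ sym)
  1≤∣p-x-y∣ : 1 ≤ ∣ p - x - y ∣
  1≤∣p-x-y∣ = ≤-trans (s≤s z≤n) (x∈p⇒∣p-x∣<∣p∣ z∈p-x-y)

subset-of-size : ∀ (p : Subset n) → k ≤ ∣ p ∣ → ∃ λ q → q ⊆ p × ∣ q ∣ ≡ k
subset-of-size {n} {zero} p _ = ⊥ , ⊥⊆ , ∣⊥∣≡0 n
subset-of-size {k = suc k} (inside ∷ p) (s≤s k≤∣p∣) with subset-of-size p k≤∣p∣
... | q , q⊆p , ∣q∣≡k = inside ∷ q , s⊆s q⊆p , cong suc ∣q∣≡k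
subset-of-size {k = suc k} (outside ∷ p) 1+k≤∣p∣ with subset-of-size p 1+k≤∣p∣
... | q , q⊆p , ∣q∣≡1+k = outside ∷ q , s⊆s q⊆p , ∣q∣≡1+k

two-classes-pigeonhole : j + j ≤ suc n → ∀ (P : Subset n) → j ≤ ∣ P ∣ ⊎ j ≤ ∣ ∁ P ∣
two-classes-pigeonhole {j} {n} bound P with j ≤? ∣ P ∣ | j ≤? ∣ ∁ P ∣
... | yes j≤∣P∣ | _          = inj₁ j≤∣P∣
... | _         | yes j≤∣∁P∣ = inj₂ j≤∣∁P∣
... | no j≰∣P∣  | no j≰∣∁P∣  = contradiction too-big 1+n≰n
  where
  open ≤-Reasoning
  too-big : suc (suc (∣ P ∣ + ∣ ∁ P ∣)) ≤ suc (∣ P ∣ + ∣ ∁ P ∣)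
  too-big = begin
    suc (suc (∣ P ∣ + ∣ ∁ P ∣))  ≡⟨ cong suc (sym (+-suc ∣ P ∣ ∣ ∁ P ∣)) ⟩
    suc ∣ P ∣ + suc ∣ ∁ P ∣      ≤⟨ +-mono-≤ (≰⇒> j≰∣P∣) (≰⇒> j≰∣∁P∣) ⟩
    j + j                         ≤⟨ bound ⟩
    suc n                         ≡⟨ cong suc (sym (∣p∣+∣∁p∣≡n P)) ⟩
    suc (∣ P ∣ + ∣ ∁ P ∣)        ∎

balanced-subset : n ≤ k + k → ∃ λ A → ∣ A ∣ ≤ k × ∣ ∁ A ∣ ≤ k
balanced-subset {n} {k} n≤k+k with n ≤? k
... | yes n≤k = ⊥ , ≤-trans (≤-reflexive (∣⊥∣≡0 n)) z≤n
                  , subst (_≤ k) (sym (trans (∣∁p∣≡n∸∣p∣ (⊥ {n})) (cong (n ∸_) (∣⊥∣≡0 n)))) n≤k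
... | no n≰k with subset-of-size ⊤ (subst (k ≤_) (sym (∣⊤∣≡n n)) (<⇒≤ (≰⇒> n≰k)))
...   | A , _ , ∣A∣≡k = A , ≤-reflexive ∣A∣≡k
                      , subst (_≤ k) (sym (trans (∣∁p∣≡n∸∣p∣ A) (cong (n ∸_) ∣A∣≡k)))
                                (m≤n+o⇒m∸n≤o n k n≤k+k)

∈∁⇒lookup≡outside : x ∈ ∁ p → lookup p x ≡ outside
∈∁⇒lookup≡outside {x = x} {p = p} x∈∁p with lookup p x in eq
... | inside  = contradiction (lookup⇒[]= x p eq) (x∈∁p⇒x∉p x∈∁p)
... | outside = refl

InducedMaxDegree≤ : Graph n → ℕ → Subset n → Set
InducedMaxDegree≤ G k S = ∀ v → v ∈ S → ∣ S ∩ nbhd G v ∣ ≤ k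

Independent : Graph n → Subset n → Set
Independent G T = ∀ {x y} → x ∈ T → y ∈ T → adj G x y ≡ false

Clique : Graph n → Subset n → Set
Clique G T = ∀ {x y} → x ∈ T → y ∈ T → x ≢ y → adj G x y ≡ true

IsProperColouring : Graph n → (Fin n → Bool) → Set
IsProperColouring G c = ∀ u v → adj G u v ≡ true → c u ≢ c v

module _ {G : Graph n} where

  adj⇒≢ : adj G x y ≡ true → x ≢ y
  adj⇒≢ {x = x} e refl = contradiction (trans (sym e) (adj-irrefl G x)) λ ()

  ∈nbhd⁺ : adj G v y ≡ true → y ∈ nbhd G v
  ∈nbhd⁺ {v = v} {y = y} e = lookup⇒[]= y (nbhd G v) (trans (lookup∘tabulate (adj G v) y) e)

  ∈nbhd⁻ : y ∈ nbhd G v → adj G v y ≡ true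
  ∈nbhd⁻ {y = y} {v = v} m = trans (sym (lookup∘tabulate (adj G v) y)) ([]=⇒lookup m)

  ∩⊆∩nbhd : (∀ {y} → y ∈ T → adj G x y ≡ true) → S ∩ T ⊆ S ∩ nbhd G x
  ∩⊆∩nbhd {T = T} {S = S} adjacent m =
    let y∈S , y∈T = x∈p∩q⁻ S T m in x∈p∩q⁺ (y∈S , ∈nbhd⁺ (adjacent y∈T))

  complement-adj⁺ : adj G x y ≡ false → x ≢ y → adj (complement G) x y ≡ true
  complement-adj⁺ {x = x} {y = y} nonadj x≢y with adj G x y | x ≟ y
  ... | false | no _    = refl
  ... | false | yes x≡y = contradiction x≡y x≢y
  ... | true  | _       = contradiction nonadj λ ()

  complement-adj⁻ : adj (complement G) x y ≡ true → adj G x y ≡ false × x ≢ y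
  complement-adj⁻ {x = x} {y = y} e with adj G x y | x ≟ y
  complement-adj⁻ () | true  | _
  complement-adj⁻ () | false | yes _
  ... | false | no x≢y = refl , x≢y

  InducedMaxDegree≤-⊆ : T ⊆ S → InducedMaxDegree≤ G k S → InducedMaxDegree≤ G k T
  InducedMaxDegree≤-⊆ {T = T} {S = S} T⊆S deg v v∈T =
    ≤-trans (p⊆q⇒∣p∣≤∣q∣ shrink) (deg v (T⊆S v∈T))
    where
    shrink : T ∩ nbhd G v ⊆ S ∩ nbhd G v
    shrink m = let y∈T , y∈N = x∈p∩q⁻ T _ m in x∈p∩q⁺ (T⊆S y∈T , y∈N)

  Independent⇒InducedMaxDegree≤ : Independent G S → InducedMaxDegree≤ G k S
  Independent⇒InducedMaxDegree≤ {S = S} ind v v∈S =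
    ≤-trans (p⊆q⇒∣p∣≤∣q∣ no-neighbours) (≤-trans (≤-reflexive (∣⊥∣≡0 n)) z≤n)
    where
    no-neighbours : S ∩ nbhd G v ⊆ ⊥
    no-neighbours m = let y∈S , y∈N = x∈p∩q⁻ S _ m in
      contradiction (trans (sym (ind v∈S y∈S)) (∈nbhd⁻ y∈N)) λ ()

  Independent⇒Clique-complement : Independent G T → Clique (complement G) T
  Independent⇒Clique-complement ind x∈T y∈T = complement-adj⁺ (ind x∈T y∈T)

  sparse-subset : InducedMaxDegree≤ G k S → j ≤ ∣ S ∣ → ∃ λ T → SparseSet G k j T
  sparse-subset {S = S} deg j≤∣S∣ with subset-of-size S j≤∣S∣
  ... | T , T⊆S , ∣T∣≡j = T , ∣T∣≡j , InducedMaxDegree≤-⊆ T⊆S deg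

  same-colour⇒nonadjacent : ∀ {c} → IsProperColouring G c → c x ≡ c y → adj G x y ≡ false
  same-colour⇒nonadjacent {x = x} {y = y} proper same with adj G x y in e
  ... | false = refl
  ... | true  = contradiction same (proper x y e)

  sides-independent : IsProperColouring G (lookup A) → Independent G A × Independent G (∁ A)
  sides-independent proper =
      (λ x∈A y∈A → same-colour⇒nonadjacent proper (trans ([]=⇒lookup x∈A) (sym ([]=⇒lookup y∈A))))
    , (λ x∈∁A y∈∁A → same-colour⇒nonadjacent proper
         (trans (∈∁⇒lookup≡outside x∈∁A) (sym (∈∁⇒lookup≡outside y∈∁A))))

Independent-⊆ : ∀ {G : Graph n} → T ⊆ S → Independent G S → Independent G T
Independent-⊆ T⊆S ind x∈T y∈T = ind (T⊆S x∈T) (T⊆S y∈T)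

clique-size≤ : ∀ {H : Graph n} → InducedMaxDegree≤ H k S → T ⊆ S → Clique H T → ∣ T ∣ ≤ suc k
clique-size≤ {k = k} {S = S} {T = T} {H = H} deg T⊆S clique with ∣p∣≡0⊎Nonempty T
... | inj₁ ∣T∣≡0       = ≤-trans (≤-reflexive ∣T∣≡0) z≤n
... | inj₂ (x , x∈T) = begin
  ∣ T ∣                               ≡⟨ ∣p∣≡∣p∩q∣+∣p∩∁q∣ T ⁅ x ⁆ ⟩
  ∣ T ∩ ⁅ x ⁆ ∣ + ∣ T ∩ ∁ ⁅ x ⁆ ∣  ≤⟨ +-mono-≤ ∣T∩⁅x⁆∣≤1 (p⊆q⇒∣p∣≤∣q∣ others⊆nbhd) ⟩
  1 + ∣ S ∩ nbhd H x ∣               ≤⟨ s≤s (deg x (T⊆S x∈T)) ⟩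
  suc k                               ∎
  where
  open ≤-Reasoning
  ∣T∩⁅x⁆∣≤1 : ∣ T ∩ ⁅ x ⁆ ∣ ≤ 1
  ∣T∩⁅x⁆∣≤1 = ≤-trans (∣p∩q∣≤∣q∣ T ⁅ x ⁆) (≤-reflexive (∣⁅x⁆∣≡1 x))
  others⊆nbhd : T ∩ ∁ ⁅ x ⁆ ⊆ S ∩ nbhd H x
  others⊆nbhd m = let y∈T , y∈∁⁅x⁆ = x∈p∩q⁻ T _ m in
    x∈p∩q⁺ (T⊆S y∈T , ∈nbhd⁺ {G = H} (clique x∈T y∈T λ x≡y →
      x∈∁p⇒x∉p y∈∁⁅x⁆ (subst (_∈ ⁅ x ⁆) x≡y (x∈⁅x⁆ x))))

proper-subset-colouring : ∀ {G : Graph n} → Bipartite G → ∃ λ A → IsProperColouring G (lookup A)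
proper-subset-colouring (c , proper) = tabulate c , λ u v e same →
  proper u v e (trans (sym (lookup∘tabulate c u)) (trans same (lookup∘tabulate c v)))

completeBipartite : Subset n → Graph n
completeBipartite A = record
  { adj        = λ x y → lookup A x xor lookup A y
  ; adj-sym    = λ x y → xor-comm (lookup A x) (lookup A y)
  ; adj-irrefl = λ x → xor-same (lookup A x)
  }

completeBipartite-proper : ∀ (A : Subset n) → IsProperColouring (completeBipartite A) (lookup A)
completeBipartite-proper A x y e same = contradiction
  (trans (sym (xor-same (lookup A y))) (subst (λ a → a xor lookup A y ≡ true) same e)) λ ()

completeBipartite-cross : x ∈ A → y ∈ ∁ A → adj (completeBipartite A) x y ≡ true
completeBipartite-cross {A = A} x∈A y∈∁A =
  subst₂ (λ a b → a xor b ≡ true) (sym ([]=⇒lookup x∈A)) (sym (∈∁⇒lookup≡outside y∈∁A)) refl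

completeBipartite-dense-size : ∀ (A : Subset n) →
  InducedMaxDegree≤ (complement (completeBipartite A)) 1 S → ∣ S ∣ ≤ 4
completeBipartite-dense-size {S = S} A deg = begin
  ∣ S ∣                           ≡⟨ ∣p∣≡∣p∩q∣+∣p∩∁q∣ S A ⟩
  ∣ S ∩ A ∣ + ∣ S ∩ ∁ A ∣       ≤⟨ +-mono-≤ (side-size A (proj₁ sides)) (side-size (∁ A) (proj₂ sides)) ⟩
  2 + 2                           ∎
  where
  open ≤-Reasoning
  sides : Independent (completeBipartite A) A × Independent (completeBipartite A) (∁ A)
  sides = sides-independent {G = completeBipartite A} (completeBipartite-proper A)
  side-size : ∀ P → Independent (completeBipartite A) P → ∣ S ∩ P ∣ ≤ 2
  side-size P ind = clique-size≤ {H = complement (completeBipartite A)} deg (p∩q⊆p S P)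
    (Independent⇒Clique-complement {G = completeBipartite A}
      (Independent-⊆ {G = completeBipartite A} (λ m → proj₂ (x∈p∩q⁻ S P m)) ind))

completeBipartite-sparse-size : ∀ (A : Subset n) → 2 ≤ k → ∣ A ∣ ≤ k → ∣ ∁ A ∣ ≤ k →
  InducedMaxDegree≤ (completeBipartite A) 1 S → ∣ S ∣ ≤ k
completeBipartite-sparse-size {k = k} {S = S} A 2≤k ∣A∣≤k ∣∁A∣≤k deg =
  ≤-trans (≤-reflexive (∣p∣≡∣p∩q∣+∣p∩∁q∣ S A))
          (parts (∣p∣≡0⊎Nonempty (S ∩ A)) (∣p∣≡0⊎Nonempty (S ∩ ∁ A)))
  where
  ∣S∩A∣≤k : ∣ S ∩ A ∣ ≤ k
  ∣S∩A∣≤k = ≤-trans (∣p∩q∣≤∣q∣ S A) ∣A∣≤k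
  ∣S∩∁A∣≤k : ∣ S ∩ ∁ A ∣ ≤ k
  ∣S∩∁A∣≤k = ≤-trans (∣p∩q∣≤∣q∣ S (∁ A)) ∣∁A∣≤k
  parts : ∣ S ∩ A ∣ ≡ 0 ⊎ Nonempty (S ∩ A) → ∣ S ∩ ∁ A ∣ ≡ 0 ⊎ Nonempty (S ∩ ∁ A) →
          ∣ S ∩ A ∣ + ∣ S ∩ ∁ A ∣ ≤ k
  parts (inj₁ a≡0) _ = subst (λ a → a + ∣ S ∩ ∁ A ∣ ≤ k) (sym a≡0) ∣S∩∁A∣≤k
  parts _ (inj₁ b≡0) =
    subst (λ b → ∣ S ∩ A ∣ + b ≤ k) (sym b≡0) (subst (_≤ k) (sym (+-identityʳ ∣ S ∩ A ∣)) ∣S∩A∣≤k)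
  parts (inj₂ (x , x∈S∩A)) (inj₂ (y , y∈S∩∁A)) = ≤-trans (+-mono-≤ ∣S∩A∣≤1 ∣S∩∁A∣≤1) 2≤k
    where
    x∈ : x ∈ S × x ∈ A
    x∈ = x∈p∩q⁻ S A x∈S∩A
    y∈ : y ∈ S × y ∈ ∁ A
    y∈ = x∈p∩q⁻ S (∁ A) y∈S∩∁A
    ∣S∩∁A∣≤1 : ∣ S ∩ ∁ A ∣ ≤ 1
    ∣S∩∁A∣≤1 = ≤-trans
      (p⊆q⇒∣p∣≤∣q∣ (∩⊆∩nbhd {G = completeBipartite A} {T = ∁ A} {S = S}
        (completeBipartite-cross (proj₂ x∈))))
      (deg x (proj₁ x∈))
    ∣S∩A∣≤1 : ∣ S ∩ A ∣ ≤ 1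
    ∣S∩A∣≤1 = ≤-trans
      (p⊆q⇒∣p∣≤∣q∣ (∩⊆∩nbhd {G = completeBipartite A} {T = A} {S = S} λ z∈A →
        trans (adj-sym (completeBipartite A) y _) (completeBipartite-cross z∈A (proj₂ y∈))))
      (deg y (proj₁ y∈))

two-neighbours⇒dense-triple : ∀ (G : Graph n) → adj G v u ≡ true → adj G v w ≡ true → u ≢ w →
                              ∃ λ S → DenseSet G 1 3 S
two-neighbours⇒dense-triple {v = v} {u = u} {w = w} G vu vw u≢w =
  let S , S⊆C , ∣S∣≡3 = subset-of-size C 3≤∣C∣
  in  S , ∣S∣≡3 , InducedMaxDegree≤-⊆ {G = complement G} S⊆C C-dense
  where
  C = ⁅ v ⁆ ∪ ⁅ u ⁆ ∪ ⁅ w ⁆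
  v∈C : v ∈ C
  v∈C = x∈p∪q⁺ (inj₁ (x∈⁅x⁆ v))
  u∈C : u ∈ C
  u∈C = x∈p∪q⁺ (inj₂ (x∈p∪q⁺ (inj₁ (x∈⁅x⁆ u))))
  w∈C : w ∈ C
  w∈C = x∈p∪q⁺ (inj₂ (x∈p∪q⁺ (inj₂ (x∈⁅x⁆ w))))
  3≤∣C∣ : 3 ≤ ∣ C ∣
  3≤∣C∣ = three-distinct⇒3≤∣p∣ v∈C u∈C w∈C (adj⇒≢ {G = G} vu) (adj⇒≢ {G = G} vw) u≢w

  ∈C⁻ : x ∈ C → x ≡ v ⊎ x ≡ u ⊎ x ≡ w
  ∈C⁻ {x = x} x∈C with x∈p∪q⁻ ⁅ v ⁆ _ x∈C
  ... | inj₁ x∈⁅v⁆ = inj₁ (x∈⁅y⁆⇒x≡y v x∈⁅v⁆)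
  ... | inj₂ x∈⁅u,w⁆ with x∈p∪q⁻ ⁅ u ⁆ _ x∈⁅u,w⁆
  ...   | inj₁ x∈⁅u⁆ = inj₂ (inj₁ (x∈⁅y⁆⇒x≡y u x∈⁅u⁆))
  ...   | inj₂ x∈⁅w⁆ = inj₂ (inj₂ (x∈⁅y⁆⇒x≡y w x∈⁅w⁆))

  edge≢nonedge : adj G x y ≡ true → adj G x y ≢ false
  edge≢nonedge e ne = contradiction (trans (sym e) ne) λ ()

  complement-edge : x ∈ C → y ∈ C → adj (complement G) x y ≡ true → x ≡ u × y ≡ w ⊎ x ≡ w × y ≡ u
  complement-edge x∈C y∈C e with complement-adj⁻ {G = G} e | ∈C⁻ x∈C | ∈C⁻ y∈C
  ... | _ , x≢y | inj₁ refl        | inj₁ refl        = contradiction refl x≢y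
  ... | ne , _  | inj₁ refl        | inj₂ (inj₁ refl) = contradiction ne (edge≢nonedge vu)
  ... | ne , _  | inj₁ refl        | inj₂ (inj₂ refl) = contradiction ne (edge≢nonedge vw)
  ... | ne , _  | inj₂ (inj₁ refl) | inj₁ refl        =
    contradiction ne (edge≢nonedge (trans (adj-sym G u v) vu))
  ... | _ , x≢y | inj₂ (inj₁ refl) | inj₂ (inj₁ refl) = contradiction refl x≢y
  ... | _       | inj₂ (inj₁ x≡u)  | inj₂ (inj₂ y≡w)  = inj₁ (x≡u , y≡w)
  ... | ne , _  | inj₂ (inj₂ refl) | inj₁ refl        =
    contradiction ne (edge≢nonedge (trans (adj-sym G w v) vw))
  ... | _       | inj₂ (inj₂ x≡w)  | inj₂ (inj₁ y≡u)  = inj₂ (x≡w , y≡u)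
  ... | _ , x≢y | inj₂ (inj₂ refl) | inj₂ (inj₂ refl) = contradiction refl x≢y

  C-dense : InducedMaxDegree≤ (complement G) 1 C
  C-dense x x∈C = subsingleton⇒∣p∣≤1 unique-partner
    where
    unique-partner : y ∈ C ∩ nbhd (complement G) x → z ∈ C ∩ nbhd (complement G) x → y ≡ z
    unique-partner y∈ z∈ with x∈p∩q⁻ C _ y∈ | x∈p∩q⁻ C _ z∈
    ... | y∈C , y∈N | z∈C , z∈N
      with complement-edge x∈C y∈C (∈nbhd⁻ {G = complement G} y∈N)
         | complement-edge x∈C z∈C (∈nbhd⁻ {G = complement G} z∈N)
    ... | inj₁ (_ , y≡w)    | inj₁ (_ , z≡w)    = trans y≡w (sym z≡w)
    ... | inj₂ (_ , y≡u)    | inj₂ (_ , z≡u)    = trans y≡u (sym z≡u)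
    ... | inj₁ (x≡u , _)    | inj₂ (x≡w , _)    = contradiction (trans (sym x≡u) x≡w) u≢w
    ... | inj₂ (x≡w , _)    | inj₁ (x≡u , _)    = contradiction (trans (sym x≡u) x≡w) u≢w

dense-triple-or-sparse-all : ∀ (G : Graph n) → HasDenseOrSparse G 1 3 n
dense-triple-or-sparse-all {n} G with all? (λ v → ∣ nbhd G v ∣ ≤? 1)
... | yes deg≤1 = inj₂ (⊤ , ∣⊤∣≡n n , λ v _ →
                    subst (λ p → ∣ p ∣ ≤ 1) (sym (∩-identityˡ (nbhd G v))) (deg≤1 v))
... | no ¬deg≤1 with ¬∀⟶∃¬ n _ (λ v → ∣ nbhd G v ∣ ≤? 1) ¬deg≤1
...   | v , deg≰1 with two-distinct (nbhd G v) (≰⇒> deg≰1)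
...     | u , w , u∈N , w∈N , u≢w =
          inj₁ (two-neighbours⇒dense-triple G (∈nbhd⁻ {G = G} u∈N) (∈nbhd⁻ {G = G} w∈N) u≢w)

-- completeBipartite ⊥ puts every vertex on the same side: it is the edgeless graph.
¬RamseyProp-edgeless : n < j → ¬ RamseyProp Bipartite 1 3 j n
¬RamseyProp-edgeless {n} n<j ramsey
  with ramsey (completeBipartite ⊥) (lookup ⊥ , completeBipartite-proper ⊥)
... | inj₂ (S , ∣S∣≡j , _)   = <⇒≱ n<j (≤-trans (≤-reflexive (sym ∣S∣≡j)) (∣p∣≤n S))
... | inj₁ (S , ∣S∣≡3 , deg) =
  contradiction (≤-trans (≤-reflexive (sym ∣S∣≡3)) (clique-size≤ {H = H} deg id S-clique))
                λ { (s≤s (s≤s ())) }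
  where
  H = complement (completeBipartite (⊥ {n}))
  S-clique : Clique H S
  S-clique = Independent⇒Clique-complement {G = completeBipartite ⊥}
    (Independent-⊆ {G = completeBipartite ⊥} (λ _ → x∉p⇒x∈∁p ∉⊥)
      (proj₂ (sides-independent {G = completeBipartite ⊥} (completeBipartite-proper ⊥))))

large-side-sparse : j + j ≤ suc n → RamseyProp Bipartite k i j n
large-side-sparse bound G bipartite with proper-subset-colouring {G = G} bipartite
... | A , proper with sides-independent {G = G} {A = A} proper | two-classes-pigeonhole bound A
...   | indA , _   | inj₁ j≤∣A∣  =
          inj₂ (sparse-subset {G = G} (Independent⇒InducedMaxDegree≤ {G = G} indA) j≤∣A∣)
...   | _ , ind∁A | inj₂ j≤∣∁A∣ =
          inj₂ (sparse-subset {G = G} (Independent⇒InducedMaxDegree≤ {G = G} ind∁A) j≤∣∁A∣)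

¬RamseyProp-completeBipartite : 5 ≤ i → 2 ≤ k → n ≤ k + k → ¬ RamseyProp Bipartite 1 i (suc k) n
¬RamseyProp-completeBipartite 5≤i 2≤k n≤k+k ramsey with balanced-subset n≤k+k
... | A , ∣A∣≤k , ∣∁A∣≤k with ramsey (completeBipartite A) (lookup A , completeBipartite-proper A)
...   | inj₁ (S , ∣S∣≡i , deg) = contradiction
          (≤-trans (≤-trans 5≤i (≤-reflexive (sym ∣S∣≡i))) (completeBipartite-dense-size A deg))
          λ { (s≤s (s≤s (s≤s (s≤s ())))) }
...   | inj₂ (S , ∣S∣≡1+k , deg) =
          1+n≰n (≤-trans (≤-reflexive (sym ∣S∣≡1+k))
                         (completeBipartite-sparse-size A 2≤k ∣A∣≤k ∣∁A∣≤k deg))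

suc[2*[1+k]∸1]≡[1+k]+[1+k] : ∀ k → suc (2 * suc k ∸ 1) ≡ suc k + suc k
suc[2*[1+k]∸1]≡[1+k]+[1+k] k = cong (λ m → suc (k + m)) (+-identityʳ (suc k))

n<2*[1+k]∸1⇒n≤k+k : n < 2 * suc k ∸ 1 → n ≤ k + k
n<2*[1+k]∸1⇒n≤k+k {k = k} n<2j∸1 = ≤-pred (≤-trans
  (≤-pred (≤-trans (s≤s n<2j∸1) (≤-reflexive (suc[2*[1+k]∸1]≡[1+k]+[1+k] k))))
  (≤-reflexive (+-suc k k)))

theorem5p2 : ((j : ℕ) → 3 ≤ j → RamseyNumberIs Bipartite 1 3 j j)
    × ((i j : ℕ) → 5 ≤ i → 3 ≤ j → RamseyNumberIs Bipartite 1 i j (2 * j ∸ 1))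
theorem5p2 =
    (λ j _ → (λ G _ → dense-triple-or-sparse-all G) , λ n → ¬RamseyProp-edgeless)
  , λ { i (suc k) 5≤i (s≤s 2≤k) →
          large-side-sparse (≤-reflexive (sym (suc[2*[1+k]∸1]≡[1+k]+[1+k] k)))
        , λ n n<2j∸1 → ¬RamseyProp-completeBipartite 5≤i 2≤k (n<2*[1+k]∸1⇒n≤k+k n<2j∸1) }
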